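{- Let $L:\mathcal U$ be a $\mathcal V$-sup-lattice with a basis $\beta:B\to L$. If $\text{Prop-Resizing}_{\mathcal U\sqcup\mathcal V^+,\mathcal V}$ holds, then every monotone endomap $f:L\to L$ has a least fixed point: there is $p:L$ with $f(p)=p$ and $p\le x$ for every $x:L$ with $f(x)=x$.
   Context: We work in Martin-Löf type theory with non-cumulative universes (successor $\mathcal V^+$, join $\sqcup$), function extensionality, propositional extensionality, propositional truncations and quotient inductive type families. $\text{Prop-Resizing}_{\mathcal U',\mathcal V}$ is the principle that every proposition in universe $\mathcal U'$ is equivalent to a proposition in universe $\mathcal V$. A type is $\mathcal V$-small if equivalent to a type in $\mathcal V$. A poset: type $P:\mathcal U$ with proposition-valued reflexive antisymmetric transitive $\le:P\to P\to\mathcal W$; $f$ monotone if $x\le y\to f(x)\le f(y)$. A $\mathcal V$-sup-lattice: poset $L:\mathcal U$ in which every family $\alpha:I\to L$ with $I:\mathcal V$ has a least upper bound. A basis: type $B:\mathcal V$ and $\beta:B\to L$ such that (1) for all $b:B$, $x:L$ the type $\beta(b)\le x$ is $\mathcal V$-small, and (2) every $x:L$ is the least upper bound of $\beta\circ\mathrm{pr}_1:(\sum_{b:B}\beta(b)\le x)\to L$. -}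

module Defs where

open import Level using (Level; _⊔_; suc; Setω)
open import Data.Product using (Σ; _×_; proj₁)
open import Function.Bundles using (_↔_)
open import Relation.Binary.PropositionalEquality using (_≡_)

FunExt : Setω
FunExt = ∀ {a b : Level} {A : Set a} {B : A → Set b} {f g : (x : A) → B x}
       → ((x : A) → f x ≡ g x) → f ≡ g

isProp : ∀ {a} → Set a → Set a
isProp X = (x y : X) → x ≡ y

PropExt : Setω
PropExt = ∀ {a : Level} {P Q : Set a} → isProp P → isProp Q
        → (P → Q) → (Q → P) → P ≡ Q

IsSmall : ∀ {a} (v : Level) → Set a → Set (a ⊔ suc v)
IsSmall v X = Σ (Set v) (λ Y → Y ↔ X)

PropResizing : (u' v : Level) → Set (suc u' ⊔ suc v)
PropResizing u' v = (P : Set u') → isProp P → Σ (Set v) (λ Q → isProp Q × (Q ↔ P))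

record IsPoset {u w} (P : Set u) (_≤_ : P → P → Set w) : Set (u ⊔ w) where
  field
    ≤-prop    : ∀ x y → isProp (x ≤ y)
    ≤-refl    : ∀ x → x ≤ x
    ≤-antisym : ∀ {x y} → x ≤ y → y ≤ x → x ≡ y
    ≤-trans   : ∀ {x y z} → x ≤ y → y ≤ z → x ≤ z

IsLub : ∀ {u w i} {P : Set u} (_≤_ : P → P → Set w) {I : Set i} (α : I → P) (s : P) → Set (u ⊔ w ⊔ i)
IsLub {P = P} _≤_ {I} α s = ((j : I) → α j ≤ s) × ((t : P) → ((j : I) → α j ≤ t) → s ≤ t)

-- 𝓥-sup-lattice: poset in which every 𝓥-indexed family has a least upper bound
-- (lubs are unique, so giving them as data is equivalent to mere existence).
record IsSupLattice {u w} (v : Level) (L : Set u) (_≤_ : L → L → Set w) : Set (u ⊔ w ⊔ suc v) where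
  field
    isPoset : IsPoset L _≤_
    ⋁       : {I : Set v} (α : I → L) → L
    ⋁-lub   : {I : Set v} (α : I → L) → IsLub _≤_ α (⋁ α)

record IsBasis {u w v} {L : Set u} (_≤_ : L → L → Set w) {B : Set v} (β : B → L) : Set (u ⊔ w ⊔ suc v) where
  field
    ≤-small : (b : B) (x : L) → IsSmall v (β b ≤ x)
    ↓-lub   : (x : L) → IsLub _≤_ {I = Σ B (λ b → β b ≤ x)} (λ p → β (proj₁ p)) x

Monotone : ∀ {u w} {L : Set u} (_≤_ : L → L → Set w) → (L → L) → Set (u ⊔ w)
Monotone _≤_ f = ∀ {x y} → x ≤ y → f x ≤ f y

module Submission where

-- Knaster–Tarski: the least fixed point is the meet of the pre-fixed points
-- {x ∣ f x ≤ x}.  A 𝓥-sup-lattice need not have meets of large families, but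
-- with a basis β the meet of any 𝓥-valued predicate P can be built as the join
-- of the basic elements below every element of P; resizing makes the index
-- type of that join small.  The basis also makes f x ≤ x equivalent to a
-- 𝓥-valued predicate, so the pre-fixed points form such a P.

open import Defs
open import Level using (Level; _⊔_; suc; Lift; lift; lower)
open import Data.Product using (Σ; _×_; _,_; proj₁; proj₂)
open import Function.Bundles using (_↔_; Inverse)
open import Relation.Binary.PropositionalEquality using (_≡_; sym; cong; subst; module ≡-Reasoning)

isProp-↔ : ∀ {a b} {Y : Set a} {X : Set b} → Y ↔ X → isProp X → isProp Y
isProp-↔ Y↔X isPropX y y′ = begin
  y                 ≡⟨ sym (strictlyInverseʳ y) ⟩
  from (to y)       ≡⟨ cong from (isPropX (to y) (to y′)) ⟩
  from (to y′)      ≡⟨ strictlyInverseʳ y′ ⟩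
  y′                ∎
  where
  open Inverse Y↔X
  open ≡-Reasoning

module _ {u w} {L : Set u} {_≤_ : L → L → Set w} (isPoset : IsPoset L _≤_)
         {f : L → L} (mono : Monotone _≤_ f) where
  open IsPoset isPoset

  leastPrefixedPoint⇒leastFixedPoint : (p : L) → f p ≤ p → ((x : L) → f x ≤ x → p ≤ x)
    → (f p ≡ p) × ((x : L) → f x ≡ x → p ≤ x)
  leastPrefixedPoint⇒leastFixedPoint p fp≤p least =
      ≤-antisym fp≤p (least (f p) (mono fp≤p))
    , λ x fx≡x → least x (subst (f x ≤_) fx≡x (≤-refl (f x)))

module WithBasis {u w v} {L : Set u} {_≤_ : L → L → Set w} (isSupLattice : IsSupLattice v L _≤_)
                 {B : Set v} {β : B → L} (isBasis : IsBasis _≤_ β) where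
  open IsSupLattice isSupLattice
  open IsPoset isPoset
  open IsBasis isBasis

  _≤ᵇ_ : B → L → Set v
  b ≤ᵇ x = proj₁ (≤-small b x)

  ≤ᵇ↔≤ : ∀ b x → b ≤ᵇ x ↔ (β b ≤ x)
  ≤ᵇ↔≤ b x = proj₂ (≤-small b x)

  ≤ᵇ⇒≤ : ∀ {b x} → b ≤ᵇ x → β b ≤ x
  ≤ᵇ⇒≤ {b} {x} = Inverse.to (≤ᵇ↔≤ b x)

  ≤⇒≤ᵇ : ∀ {b x} → β b ≤ x → b ≤ᵇ x
  ≤⇒≤ᵇ {b} {x} = Inverse.from (≤ᵇ↔≤ b x)

  ≤ᵇ-prop : ∀ b x → isProp (b ≤ᵇ x)
  ≤ᵇ-prop b x = isProp-↔ (≤ᵇ↔≤ b x) (≤-prop (β b) x)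

  _⊑_ : L → L → Set v
  x ⊑ y = (b : B) → b ≤ᵇ x → b ≤ᵇ y

  ≤⇒⊑ : ∀ {x y} → x ≤ y → x ⊑ y
  ≤⇒⊑ x≤y b b≤ᵇx = ≤⇒≤ᵇ (≤-trans (≤ᵇ⇒≤ b≤ᵇx) x≤y)

  ⊑⇒≤ : ∀ {x y} → x ⊑ y → x ≤ y
  ⊑⇒≤ {x} {y} x⊑y = proj₂ (↓-lub x) y (λ { (b , βb≤x) → ≤ᵇ⇒≤ (x⊑y b (≤⇒≤ᵇ βb≤x)) })

  module Meet (funExt : FunExt) (resizing : PropResizing (u ⊔ suc v) v) (P : L → Set v) where

    BelowAll : B → Set (u ⊔ v)
    BelowAll b = (x : L) → P x → b ≤ᵇ x

    BelowAll-prop : ∀ b → isProp (BelowAll b)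
    BelowAll-prop b q q′ = funExt λ x → funExt λ Px → ≤ᵇ-prop b x (q x Px) (q′ x Px)

    private
      resized : (b : B) → Σ (Set v) (λ Q → isProp Q × (Q ↔ Lift (u ⊔ suc v) (BelowAll b)))
      resized b = resizing (Lift (u ⊔ suc v) (BelowAll b))
                           (λ { (lift q) (lift q′) → cong lift (BelowAll-prop b q q′) })

    BelowAllᵥ : B → Set v
    BelowAllᵥ b = proj₁ (resized b)

    BelowAllᵥ⇒BelowAll : ∀ {b} → BelowAllᵥ b → BelowAll b
    BelowAllᵥ⇒BelowAll {b} q = lower (Inverse.to (proj₂ (proj₂ (resized b))) q)

    BelowAll⇒BelowAllᵥ : ∀ {b} → BelowAll b → BelowAllᵥ b
    BelowAll⇒BelowAllᵥ {b} q = Inverse.from (proj₂ (proj₂ (resized b))) (lift q)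

    ⋀ : L
    ⋀ = ⋁ {I = Σ B BelowAllᵥ} (λ i → β (proj₁ i))

    ⋀-lowerBound : ∀ x → P x → ⋀ ≤ x
    ⋀-lowerBound x Px =
      proj₂ (⋁-lub _) x (λ { (b , q) → ≤ᵇ⇒≤ (BelowAllᵥ⇒BelowAll q x Px) })

    ⋀-greatest : ∀ y → (∀ x → P x → y ≤ x) → y ≤ ⋀
    ⋀-greatest y y≤P = proj₂ (↓-lub y) ⋀ λ { (b , βb≤y) →
      proj₁ (⋁-lub _) (b , BelowAll⇒BelowAllᵥ λ x Px → ≤⇒≤ᵇ (≤-trans βb≤y (y≤P x Px))) }

  module KnasterTarski (funExt : FunExt) (resizing : PropResizing (u ⊔ suc v) v)
                       {f : L → L} (mono : Monotone _≤_ f) where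
    open Meet funExt resizing (λ x → f x ⊑ x)

    leastPrefixedPoint : L
    leastPrefixedPoint = ⋀

    leastPrefixedPoint-least : ∀ x → f x ≤ x → leastPrefixedPoint ≤ x
    leastPrefixedPoint-least x fx≤x = ⋀-lowerBound x (≤⇒⊑ fx≤x)

    leastPrefixedPoint-prefixed : f leastPrefixedPoint ≤ leastPrefixedPoint
    leastPrefixedPoint-prefixed = ⋀-greatest (f ⋀) λ x fx⊑x →
      ≤-trans (mono (⋀-lowerBound x fx⊑x)) (⊑⇒≤ fx⊑x)

corollary7p6 : FunExt → PropExt
    → {u v w : Level} (L : Set u) (_≤_ : L → L → Set w)
    → IsSupLattice v L _≤_
    → (B : Set v) (β : B → L) → IsBasis _≤_ β
    → PropResizing (u ⊔ suc v) v
    → (f : L → L) → Monotone _≤_ f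
    → Σ L (λ p → (f p ≡ p) × ((x : L) → f x ≡ x → p ≤ x))
corollary7p6 funExt _ L _≤_ isSupLattice B β isBasis resizing f mono =
  leastPrefixedPoint ,
  leastPrefixedPoint⇒leastFixedPoint (IsSupLattice.isPoset isSupLattice) mono
    leastPrefixedPoint leastPrefixedPoint-prefixed leastPrefixedPoint-least
  where open WithBasis.KnasterTarski isSupLattice isBasis funExt resizing mono
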